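{- Let $(d_1,m_1)\succeq (d_2,m_2)\succeq\cdots\succeq(d_n,m_n)$ be a sequence of ordered pairs of positive real numbers. If this is the sequence of degree pairs of a finite simple graph $G$ of order $n$ without isolated vertices (i.e. the vertices of $G$ can be labeled $1,\dots,n$ so that vertex $i$ has degree $d_i$ and average $2$-degree $m_i$), then: (i) $d_i$ and $d_im_i$ are positive integers for $i=1,\dots,n$; (ii) $d_im_i\leq \sum_{j=1}^{d_i+1}d_j-d_{\min\{d_i+1,i\}}$ for $i=1,\dots,n$; (iii) $d_im_i\geq \sum_{j=n-d_i}^{n}d_j-d_{\max\{n-d_i,i\}}$ for $i=1,\dots,n$; (iv) $\sum_{i=1}^n d_im_i=\sum_{i=1}^n d_i^2$; (v) $\sum_{i=1}^n d_i$ is even (and so is $\sum_{i=1}^n d_im_i$); (vi) $\sum_{i=1}^k d_i\leq k(k-1)+\sum_{i=k+1}^n\min\{d_i,k\}$ for $k=1,\dots,n$; (vii) $\sum_{i=1}^k d_im_i\leq \sum_{i=1}^k d_i\min\{d_i,k-1\}+\sum_{i=k+1}^n d_i\min\{d_i,k\}$ for $k=1,\dots,n$.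
   Context: For a vertex $i$ of a graph, $d_i$ is its degree and $m_i=d_i^{ -1}\sum_{j:\, ji\in E(G)} d_j$ is its average $2$-degree (mean of the degrees of its neighbors); $(d_i,m_i)$ is its degree pair. For real numbers, $(a_1,b_1)\succeq(a_2,b_2)$ means $a_1>a_2$, or $a_1=a_2$ and $b_1\geq b_2$ (a total order on $\mathbb{R}^2$).
   Formalization: The ordered pairs $(d_i,m_i)$ have rational entries rather than positive real ones. -}

module Defs where

open import Data.Bool using (Bool; true; false; if_then_else_)
open import Data.Nat using (ℕ; zero; suc; _+_; _∸_)
open import Data.Fin using (Fin; zero; suc)
open import Data.Integer using (ℤ; +_)
open import Data.Rational using (ℚ; 0ℚ; _/_; _<_; _≤_)
import Data.Rational as Q
open import Data.Product using (_×_)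
open import Data.Sum using (_⊎_)
open import Relation.Binary.PropositionalEquality using (_≡_)

ℕ→ℚ : ℕ → ℚ
ℕ→ℚ k = + k / 1

ℤ→ℚ : ℤ → ℚ
ℤ→ℚ k = k / 1

record SimpleGraph (n : ℕ) : Set where
  field
    adj    : Fin n → Fin n → Bool
    sym    : ∀ i j → adj i j ≡ adj j i
    irrefl : ∀ i → adj i i ≡ false
open SimpleGraph public

sumFin : ∀ {n} → (Fin n → ℕ) → ℕ
sumFin {zero}  f = 0
sumFin {suc n} f = f zero + sumFin {n} (λ j → f (suc j))

degree : ∀ {n} → SimpleGraph n → Fin n → ℕ
degree G i = sumFin (λ j → if adj G i j then 1 else 0)

neighbourDegreeSum : ∀ {n} → SimpleGraph n → Fin n → ℕ
neighbourDegreeSum G i = sumFin (λ j → if adj G i j then degree G j else 0)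

-- s / d as a rational (only used with d ≥ 1; value 0 when d = 0, a
-- convention that is irrelevant since isolated vertices are excluded)
divℚ : ℕ → ℕ → ℚ
divℚ s zero    = 0ℚ
divℚ s (suc d) = + s / suc d

avg2Degree : ∀ {n} → SimpleGraph n → Fin n → ℚ
avg2Degree G i = divℚ (neighbourDegreeSum G i) (degree G i)

NoIsolatedVertices : ∀ {n} → SimpleGraph n → Set
NoIsolatedVertices G = ∀ i → 0 Data.Nat.< degree G i

_⪰_ : ℚ × ℚ → ℚ × ℚ → Set
(a₁ Data.Product., b₁) ⪰ (a₂ Data.Product., b₂) = (a₂ < a₁) ⊎ (a₁ ≡ a₂ × b₂ ≤ b₁)

-- 1-based access to a sequence indexed by Fin n: at f j = f_j for 1 ≤ j ≤ n,
-- and 0 otherwise (never used out of range in the statement)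
at : ∀ {n} → (Fin n → ℚ) → ℕ → ℚ
at {zero}  f _             = 0ℚ
at {suc n} f zero          = 0ℚ
at {suc n} f (suc zero)    = f zero
at {suc n} f (suc (suc j)) = at {n} (λ x → f (suc x)) (suc j)

sumCount : (ℕ → ℚ) → ℕ → ℕ → ℚ
sumCount f a zero    = 0ℚ
sumCount f a (suc c) = f a Q.+ sumCount f (suc a) c

-- Σ_{j=a}^{b} f j  (empty, i.e. 0, if b < a)
sumRange : (ℕ → ℚ) → ℕ → ℕ → ℚ
sumRange f a b = sumCount f a (suc b ∸ a)

module Submission where

-- Every item is really a statement about natural numbers: for the adjacency
-- matrix A, d_i = Σ_j A_ij and d_i m_i = Σ_j A_ij d_j.  So the argument works
-- with ℕ-indexed sequences and sums sumFrom f a c = Σ_{a ≤ j < a + c} f j, and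
-- transfers to ℚ only at the end; the order ⪰ enters only through the degrees
-- being nonincreasing.

open import Defs hiding (sym)
open import Data.Nat using (ℕ)
open import Relation.Binary.PropositionalEquality using (_≡_)

module FiniteSums where

  open import Data.Nat
  open import Data.Nat.Properties
  open import Data.Sum using (_⊎_; inj₁; inj₂)
  open import Relation.Binary.PropositionalEquality
  open import Algebra.Properties.CommutativeSemigroup +-commutativeSemigroup
    using (interchange)

  sumFrom : (ℕ → ℕ) → ℕ → ℕ → ℕ
  sumFrom f a zero    = 0
  sumFrom f a (suc c) = f a + sumFrom f (suc a) c

  sumFrom-shift : ∀ f a c → sumFrom f (suc a) c ≡ sumFrom (λ j → f (suc j)) a c
  sumFrom-shift f a zero    = refl
  sumFrom-shift f a (suc c) = cong (f (suc a) +_) (sumFrom-shift f (suc a) c)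

  sumFrom-unfold : ∀ f c → sumFrom f 0 (suc c) ≡ f 0 + sumFrom (λ j → f (suc j)) 0 c
  sumFrom-unfold f c = cong (f 0 +_) (sumFrom-shift f 0 c)

  sumFrom-cong : ∀ {f g} a c → (∀ j → f j ≡ g j) → sumFrom f a c ≡ sumFrom g a c
  sumFrom-cong a zero    f≡g = refl
  sumFrom-cong a (suc c) f≡g = cong₂ _+_ (f≡g a) (sumFrom-cong (suc a) c f≡g)

  sumFrom-mono : ∀ {f g} a c → (∀ j → a ≤ j → j < a + c → f j ≤ g j) →
                 sumFrom f a c ≤ sumFrom g a c
  sumFrom-mono a zero    f≤g = z≤n
  sumFrom-mono a (suc c) f≤g =
    +-mono-≤ (f≤g a ≤-refl (m<m+n a z<s))
             (sumFrom-mono (suc a) c λ j a<j j<end →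
               f≤g j (<⇒≤ a<j) (subst (j <_) (sym (+-suc a c)) j<end))

  sumFrom-mono-≤ : ∀ {f g} a c → (∀ j → f j ≤ g j) → sumFrom f a c ≤ sumFrom g a c
  sumFrom-mono-≤ a c f≤g = sumFrom-mono a c (λ j _ _ → f≤g j)

  sumFrom-+ : ∀ f g a c → sumFrom (λ j → f j + g j) a c ≡ sumFrom f a c + sumFrom g a c
  sumFrom-+ f g a zero    = refl
  sumFrom-+ f g a (suc c) =
    trans (cong (f a + g a +_) (sumFrom-+ f g (suc a) c)) (interchange (f a) (g a) _ _)

  sumFrom-*ʳ : ∀ f x a c → sumFrom (λ j → f j * x) a c ≡ sumFrom f a c * x
  sumFrom-*ʳ f x a zero    = refl
  sumFrom-*ʳ f x a (suc c) =
    trans (cong (f a * x +_) (sumFrom-*ʳ f x (suc a) c)) (sym (*-distribʳ-+ x (f a) _))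

  sumFrom-const : ∀ x a c → sumFrom (λ _ → x) a c ≡ c * x
  sumFrom-const x a zero    = refl
  sumFrom-const x a (suc c) = cong (x +_) (sumFrom-const x (suc a) c)

  sumFrom-zero : ∀ a c → sumFrom (λ _ → 0) a c ≡ 0
  sumFrom-zero a c = trans (sumFrom-const 0 a c) (*-zeroʳ c)

  sumFrom-split : ∀ f a b c → sumFrom f a (b + c) ≡ sumFrom f a b + sumFrom f (a + b) c
  sumFrom-split f a zero    c = cong (λ s → sumFrom f s c) (sym (+-identityʳ a))
  sumFrom-split f a (suc b) c = begin
    f a + sumFrom f (suc a) (b + c)                  ≡⟨ cong (f a +_) (sumFrom-split f (suc a) b c) ⟩
    f a + (sumFrom f (suc a) b + sumFrom f (suc a + b) c)
      ≡⟨ cong (λ s → f a + (sumFrom f (suc a) b + sumFrom f s c)) (sym (+-suc a b)) ⟩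
    f a + (sumFrom f (suc a) b + sumFrom f (a + suc b) c) ≡⟨ sym (+-assoc (f a) _ _) ⟩
    f a + sumFrom f (suc a) b + sumFrom f (a + suc b) c ∎
    where open ≡-Reasoning

  sumFrom-split-at : ∀ f k n → k ≤ n → sumFrom f 0 n ≡ sumFrom f 0 k + sumFrom f k (n ∸ k)
  sumFrom-split-at f k n k≤n =
    trans (cong (sumFrom f 0) (sym (m+[n∸m]≡n k≤n))) (sumFrom-split f 0 k (n ∸ k))

  sumFrom-snoc : ∀ f a c → sumFrom f a (suc c) ≡ sumFrom f a c + f (a + c)
  sumFrom-snoc f a c = begin
    sumFrom f a (suc c)                   ≡⟨ cong (sumFrom f a) (+-comm 1 c) ⟩
    sumFrom f a (c + 1)                   ≡⟨ sumFrom-split f a c 1 ⟩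
    sumFrom f a c + (f (a + c) + 0)       ≡⟨ cong (sumFrom f a c +_) (+-identityʳ _) ⟩
    sumFrom f a c + f (a + c)             ∎
    where open ≡-Reasoning

  sumFrom-swap : ∀ (f : ℕ → ℕ → ℕ) a c a′ c′ →
    sumFrom (λ i → sumFrom (f i) a′ c′) a c ≡ sumFrom (λ j → sumFrom (λ i → f i j) a c) a′ c′
  sumFrom-swap f a zero    a′ c′ = sym (sumFrom-zero a′ c′)
  sumFrom-swap f a (suc c) a′ c′ =
    trans (cong (sumFrom (f a) a′ c′ +_) (sumFrom-swap f (suc a) c a′ c′))
          (sym (sumFrom-+ (f a) (λ j → sumFrom (λ i → f i j) (suc a) c) a′ c′))

  ZeroOne : (ℕ → ℕ) → Set
  ZeroOne w = ∀ j → w j ≤ 1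

  sumFrom-≤-count : ∀ w a c → ZeroOne w → sumFrom w a c ≤ c
  sumFrom-≤-count w a zero    w01 = z≤n
  sumFrom-≤-count w a (suc c) w01 = +-mono-≤ (w01 a) (sumFrom-≤-count w (suc a) c w01)

  δ : ℕ → ℕ → ℕ
  δ zero    zero    = 1
  δ zero    (suc j) = 0
  δ (suc i) zero    = 0
  δ (suc i) (suc j) = δ i j

  δ-diag : ∀ i → δ i i ≡ 1
  δ-diag zero    = refl
  δ-diag (suc i) = δ-diag i

  δ-cases : ∀ i j → i ≡ j ⊎ δ i j ≡ 0
  δ-cases zero    zero    = inj₁ refl
  δ-cases zero    (suc j) = inj₂ refl
  δ-cases (suc i) zero    = inj₂ refl
  δ-cases (suc i) (suc j) with δ-cases i j
  ... | inj₁ i≡j  = inj₁ (cong suc i≡j)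
  ... | inj₂ δ≡0  = inj₂ δ≡0

  sumFrom-δ : ∀ g n i → i < n → sumFrom (λ j → δ i j * g j) 0 n ≡ g i
  sumFrom-δ g (suc n) zero    _ = begin
    g 0 + 0 + sumFrom (λ j → δ 0 j * g j) 1 n   ≡⟨ cong₂ _+_ (+-identityʳ (g 0)) (sumFrom-shift _ 0 n) ⟩
    g 0 + sumFrom (λ _ → 0) 0 n                 ≡⟨ cong (g 0 +_) (sumFrom-zero 0 n) ⟩
    g 0 + 0                                     ≡⟨ +-identityʳ (g 0) ⟩
    g 0                                         ∎
    where open ≡-Reasoning
  sumFrom-δ g (suc n) (suc i) (s≤s i<n) =
    trans (sumFrom-shift _ 0 n) (sumFrom-δ (λ j → g (suc j)) n i i<n)

  addUnit : (ℕ → ℕ) → ℕ → ℕ → ℕ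
  addUnit w i j = w j + δ i j

  addUnit-zeroOne : ∀ w i → ZeroOne w → w i ≡ 0 → ZeroOne (addUnit w i)
  addUnit-zeroOne w i w01 wi≡0 j with δ-cases i j
  ... | inj₁ refl rewrite wi≡0 | δ-diag i = ≤-refl
  ... | inj₂ δ≡0  rewrite δ≡0 | +-identityʳ (w j) = w01 j

  addUnit-count : ∀ w i n → i < n → sumFrom (addUnit w i) 0 n ≡ suc (sumFrom w 0 n)
  addUnit-count w i n i<n = begin
    sumFrom (λ j → w j + δ i j) 0 n               ≡⟨ sumFrom-+ w (δ i) 0 n ⟩
    sumFrom w 0 n + sumFrom (δ i) 0 n             ≡⟨ cong (sumFrom w 0 n +_) unit ⟩
    sumFrom w 0 n + 1                             ≡⟨ +-comm (sumFrom w 0 n) 1 ⟩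
    suc (sumFrom w 0 n)                           ∎
    where
    open ≡-Reasoning
    unit : sumFrom (δ i) 0 n ≡ 1
    unit = trans (sumFrom-cong 0 n (λ j → sym (*-identityʳ (δ i j)))) (sumFrom-δ (λ _ → 1) n i i<n)

  addUnit-weighted : ∀ w D i n → i < n →
    sumFrom (λ j → addUnit w i j * D j) 0 n ≡ sumFrom (λ j → w j * D j) 0 n + D i
  addUnit-weighted w D i n i<n = begin
    sumFrom (λ j → (w j + δ i j) * D j) 0 n                        ≡⟨ sumFrom-cong 0 n (λ j → *-distribʳ-+ (D j) (w j) (δ i j)) ⟩
    sumFrom (λ j → w j * D j + δ i j * D j) 0 n                    ≡⟨ sumFrom-+ _ _ 0 n ⟩
    sumFrom (λ j → w j * D j) 0 n + sumFrom (λ j → δ i j * D j) 0 n ≡⟨ cong (_ +_) (sumFrom-δ D n i i<n) ⟩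
    sumFrom (λ j → w j * D j) 0 n + D i                            ∎
    where open ≡-Reasoning

  count-gap : ∀ w i n → ZeroOne w → w i ≡ 0 → i < n → suc (sumFrom w 0 n) ≤ n
  count-gap w i n w01 wi≡0 i<n =
    subst (_≤ n) (addUnit-count w i n i<n) (sumFrom-≤-count _ 0 n (addUnit-zeroOne w i w01 wi≡0))

module Rearrangement where

  open import Data.Nat
  open import Data.Nat.Properties
  open import Data.Sum using (_⊎_; inj₁; inj₂)
  open import Relation.Binary.PropositionalEquality
  open FiniteSums

  Nonincreasing : (ℕ → ℕ) → Set
  Nonincreasing D = ∀ j → D (suc j) ≤ D j

  tail : {P : ℕ → Set} → (∀ j → P j) → ∀ j → P (suc j)
  tail f j = f (suc j)

  nonincreasing-≤ : ∀ {D} → Nonincreasing D → ∀ {i j} → i ≤ j → D j ≤ D i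
  nonincreasing-≤ {D} D↓ {i} {j} i≤j =
    subst (λ k → D k ≤ D i) (m+[n∸m]≡n i≤j) (go (j ∸ i))
    where
    go : ∀ k → D (i + k) ≤ D i
    go zero    = ≤-reflexive (cong D (+-identityʳ i))
    go (suc k) = ≤-trans (subst (λ l → D l ≤ D (i + k)) (sym (+-suc i k)) (D↓ (i + k))) (go k)

  zeroOne-cases : ∀ {x} → x ≤ 1 → x ≡ 0 ⊎ x ≡ 1
  zeroOne-cases z≤n       = inj₁ refl
  zeroOne-cases (s≤s z≤n) = inj₂ refl

  weighted≤top : ∀ n D w → Nonincreasing D → ZeroOne w →
    sumFrom (λ j → w j * D j) 0 n ≤ sumFrom D 0 (sumFrom w 0 n)
  weighted≤top zero    D w D↓ w01 = z≤n
  weighted≤top (suc n) D w D↓ w01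
    rewrite sumFrom-unfold (λ j → w j * D j) n | sumFrom-unfold w n
    with zeroOne-cases (w01 0) | weighted≤top n (tail D) (tail w) (tail D↓) (tail w01)
  ... | inj₁ w0≡0 | ih rewrite w0≡0 = ≤-trans ih (sumFrom-mono-≤ 0 (sumFrom (tail w) 0 n) D↓)
  ... | inj₂ w0≡1 | ih rewrite w0≡1 | +-identityʳ (D 0) | sumFrom-shift D 0 (sumFrom (tail w) 0 n) =
    +-monoʳ-≤ (D 0) ih

  bottom≤weighted : ∀ n D w → Nonincreasing D → ZeroOne w →
    sumFrom D (n ∸ sumFrom w 0 n) (sumFrom w 0 n) ≤ sumFrom (λ j → w j * D j) 0 n
  bottom≤weighted zero    D w D↓ w01 = z≤n
  bottom≤weighted (suc n) D w D↓ w01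
    rewrite sumFrom-unfold (λ j → w j * D j) n | sumFrom-unfold w n
    with zeroOne-cases (w01 0) | bottom≤weighted n (tail D) (tail w) (tail D↓) (tail w01)
  ... | inj₁ w0≡0 | ih
    rewrite w0≡0 | +-∸-assoc 1 (sumFrom-≤-count (tail w) 0 n (tail w01))
          | sumFrom-shift D (n ∸ sumFrom (tail w) 0 n) (sumFrom (tail w) 0 n) = ih
  ... | inj₂ w0≡1 | ih
    rewrite w0≡1 | +-identityʳ (D 0)
          | sumFrom-shift D (n ∸ sumFrom (tail w) 0 n) (sumFrom (tail w) 0 n) =
    +-mono-≤ (nonincreasing-≤ D↓ z≤n) ih

  ∸-suc : ∀ {s n} → suc s ≤ n → n ∸ s ≡ suc (n ∸ suc s)
  ∸-suc (s≤s s≤n) = +-∸-assoc 1 s≤n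

  -- If moreover w vanishes at i, the first s + 1 terms of D also cover the
  -- term D (min(s, i)): either i ≥ s and D s is the next term, or i < s and
  -- adding a unit weight at i gives weights of total s + 1.
  weighted+gap≤top : ∀ n D w i → Nonincreasing D → ZeroOne w → w i ≡ 0 →
    sumFrom (λ j → w j * D j) 0 n + D (sumFrom w 0 n ⊓ i) ≤ sumFrom D 0 (suc (sumFrom w 0 n))
  weighted+gap≤top n D w i D↓ w01 wi≡0 with ≤-<-connex (sumFrom w 0 n) i
  ... | inj₁ s≤i rewrite m≤n⇒m⊓n≡m s≤i | sumFrom-snoc D 0 (sumFrom w 0 n) =
    +-monoˡ-≤ (D (sumFrom w 0 n)) (weighted≤top n D w D↓ w01)
  ... | inj₂ i<s rewrite m≥n⇒m⊓n≡n (<⇒≤ i<s) = begin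
    sumFrom (λ j → w j * D j) 0 n + D i        ≡⟨ addUnit-weighted w D i n i<n ⟨
    sumFrom (λ j → addUnit w i j * D j) 0 n    ≤⟨ weighted≤top n D (addUnit w i) D↓ (addUnit-zeroOne w i w01 wi≡0) ⟩
    sumFrom D 0 (sumFrom (addUnit w i) 0 n)    ≡⟨ cong (sumFrom D 0) (addUnit-count w i n i<n) ⟩
    sumFrom D 0 (suc (sumFrom w 0 n))          ∎
    where
    open ≤-Reasoning
    i<n : i < n
    i<n = <-≤-trans i<s (sumFrom-≤-count w 0 n w01)

  bottom≤weighted+gap : ∀ n D w i → Nonincreasing D → ZeroOne w → w i ≡ 0 → i < n →
    sumFrom D (n ∸ suc (sumFrom w 0 n)) (suc (sumFrom w 0 n))
      ≤ sumFrom (λ j → w j * D j) 0 n + D ((n ∸ suc (sumFrom w 0 n)) ⊔ i)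
  bottom≤weighted+gap n D w i D↓ w01 wi≡0 i<n with ≤-<-connex i (n ∸ suc (sumFrom w 0 n))
  ... | inj₁ i≤q rewrite m≥n⇒m⊔n≡m i≤q = begin
    D q + sumFrom D (suc q) s                  ≡⟨ cong (λ a → D q + sumFrom D a s) (∸-suc gap) ⟨
    D q + sumFrom D (n ∸ s) s                  ≤⟨ +-monoʳ-≤ (D q) (bottom≤weighted n D w D↓ w01) ⟩
    D q + sumFrom (λ j → w j * D j) 0 n        ≡⟨ +-comm (D q) _ ⟩
    sumFrom (λ j → w j * D j) 0 n + D q        ∎
    where
    open ≤-Reasoning
    s q : ℕ
    s = sumFrom w 0 n
    q = n ∸ suc s
    gap : suc s ≤ n
    gap = count-gap w i n w01 wi≡0 i<n
  ... | inj₂ q<i rewrite m≤n⇒m⊔n≡n (<⇒≤ q<i) =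
    subst₂ (λ s′ t → sumFrom D (n ∸ s′) s′ ≤ t)
      (addUnit-count w i n i<n) (addUnit-weighted w D i n i<n)
      (bottom≤weighted n D (addUnit w i) D↓ (addUnit-zeroOne w i w01 wi≡0))

module Parity where

  open import Data.Nat
  open import Data.Nat.Properties
  open import Data.Nat.Tactic.RingSolver using (solve-∀)
  open import Data.Product using (∃-syntax; _,_)
  open import Relation.Binary.PropositionalEquality
  open FiniteSums

  Even : ℕ → Set
  Even x = ∃[ t ] x ≡ 2 * t

  double-even : ∀ r → Even (r + r)
  double-even r = r , cong (r +_) (sym (+-identityʳ r))

  even-+ : ∀ {a b} → Even a → Even b → Even (a + b)
  even-+ (s , refl) (t , refl) = s + t , sym (*-distribˡ-+ 2 s t)

  sumFrom-even : ∀ f a c → (∀ j → Even (f j)) → Even (sumFrom f a c)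
  sumFrom-even f a zero    f-even = 0 , refl
  sumFrom-even f a (suc c) f-even = even-+ (f-even a) (sumFrom-even f (suc a) c f-even)

  square-parity : ∀ k → ∃[ t ] k * k ≡ k + 2 * t
  square-parity zero = 0 , refl
  square-parity (suc k) with square-parity k
  ... | t , k²≡k+2t = t + k , (begin
    suc k * suc k                 ≡⟨ expand k ⟩
    k * k + (suc k + k)           ≡⟨ cong (_+ (suc k + k)) k²≡k+2t ⟩
    k + 2 * t + (suc k + k)       ≡⟨ regroup k t ⟩
    suc k + 2 * (t + k)           ∎)
    where
    open ≡-Reasoning
    expand : ∀ k → suc k * suc k ≡ k * k + (suc k + k)
    expand = solve-∀
    regroup : ∀ k t → k + 2 * t + (suc k + k) ≡ suc k + 2 * (t + k)
    regroup = solve-∀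

  -- The entries of a symmetric matrix with zero diagonal sum to an even
  -- number: off-diagonal entries pair up.  Induction peels off the first row
  -- and column, which contribute the same amount r each.
  symmetric-sum-even : ∀ n (X : ℕ → ℕ → ℕ) → (∀ i j → X i j ≡ X j i) → (∀ i → X i i ≡ 0) →
                       Even (sumFrom (λ i → sumFrom (X i) 0 n) 0 n)
  symmetric-sum-even zero    X Xsym Xdiag = 0 , refl
  symmetric-sum-even (suc n) X Xsym Xdiag =
    subst Even (sym decomposition)
      (even-+ (double-even r)
              (symmetric-sum-even n X′ (λ i j → Xsym (suc i) (suc j)) (λ i → Xdiag (suc i))))
    where
    open ≡-Reasoning
    X′ : ℕ → ℕ → ℕ
    X′ i j = X (suc i) (suc j)
    r rest : ℕ
    r    = sumFrom (λ j → X 0 (suc j)) 0 n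
    rest = sumFrom (λ i → sumFrom (X′ i) 0 n) 0 n
    decomposition : sumFrom (λ i → sumFrom (X i) 0 (suc n)) 0 (suc n) ≡ (r + r) + rest
    decomposition = begin
      sumFrom (X 0) 0 (suc n) + sumFrom (λ i → sumFrom (X i) 0 (suc n)) 1 n
        ≡⟨ cong₂ _+_ (sumFrom-unfold (X 0) n) (sumFrom-shift _ 0 n) ⟩
      X 0 0 + r + sumFrom (λ i → sumFrom (X (suc i)) 0 (suc n)) 0 n
        ≡⟨ cong₂ (λ x y → x + r + y) (Xdiag 0) (sumFrom-cong 0 n (λ i → sumFrom-unfold (X (suc i)) n)) ⟩
      r + sumFrom (λ i → X (suc i) 0 + sumFrom (X′ i) 0 n) 0 n
        ≡⟨ cong (r +_) (sumFrom-+ _ _ 0 n) ⟩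
      r + (sumFrom (λ i → X (suc i) 0) 0 n + rest)
        ≡⟨ cong (λ x → r + (x + rest)) (sumFrom-cong 0 n (λ i → Xsym (suc i) 0)) ⟩
      r + (r + rest)
        ≡⟨ sym (+-assoc r r rest) ⟩
      r + r + rest ∎

module AdjacencyMatrix (n : ℕ) (A : ℕ → ℕ → ℕ) (A01 : ∀ i → FiniteSums.ZeroOne (A i))
                       (Asym : ∀ i j → A i j ≡ A j i) (Airr : ∀ i → A i i ≡ 0) where

  open import Data.Nat
  open import Data.Nat.Properties
  open import Data.Product using (_,_; proj₁; proj₂)
  open import Relation.Binary.PropositionalEquality
  open FiniteSums
  open Parity

  deg : ℕ → ℕ
  deg i = sumFrom (A i) 0 n

  nbrDegSum : ℕ → ℕ
  nbrDegSum i = sumFrom (λ j → A i j * deg j) 0 n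

  degree-sum-even : Even (sumFrom deg 0 n)
  degree-sum-even = symmetric-sum-even n A Asym Airr

  column : ℕ → ℕ → ℕ
  column k j = sumFrom (λ i → A i j) 0 k

  rows-as-columns : ∀ k (g : ℕ → ℕ) →
    sumFrom (λ i → sumFrom (λ j → A i j * g j) 0 n) 0 k ≡ sumFrom (λ j → column k j * g j) 0 n
  rows-as-columns k g =
    trans (sumFrom-swap (λ i j → A i j * g j) 0 k 0 n)
          (sumFrom-cong 0 n (λ j → sumFrom-*ʳ (λ i → A i j) (g j) 0 k))

  column-all : ∀ j → column n j ≡ deg j
  column-all j = sumFrom-cong 0 n (λ i → Asym i j)

  column≤deg : ∀ {k} → k ≤ n → ∀ j → column k j ≤ deg j
  column≤deg {k} k≤n j = begin
    column k j                                   ≡⟨ sumFrom-cong 0 k (λ i → Asym i j) ⟩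
    sumFrom (A j) 0 k                            ≤⟨ m≤m+n _ _ ⟩
    sumFrom (A j) 0 k + sumFrom (A j) k (n ∸ k)  ≡⟨ sumFrom-split-at (A j) k n k≤n ⟨
    deg j                                        ∎
    where open ≤-Reasoning

  column≤k : ∀ k j → column k j ≤ k
  column≤k k j = sumFrom-≤-count (λ i → A i j) 0 k (λ i → A01 i j)

  -- A vertex is not its own neighbour.
  column<k : ∀ {k j} → j < k → column k j ≤ k ∸ 1
  column<k {k} {j} j<k = ∸-monoˡ-≤ 1 (count-gap (λ i → A i j) j k (λ i → A01 i j) (Airr j) j<k)

  -- (iv): Σ d_i m_i = Σ d_i², since each d_j is counted once per neighbour.
  nbrDegSum-total : sumFrom nbrDegSum 0 n ≡ sumFrom (λ j → deg j * deg j) 0 n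
  nbrDegSum-total =
    trans (rows-as-columns n deg) (sumFrom-cong 0 n (λ j → cong (_* deg j) (column-all j)))

  -- Σ d_i m_i is even: it is Σ d_i² ≡ Σ d_i (mod 2).
  nbrDegSum-even : Even (sumFrom nbrDegSum 0 n)
  nbrDegSum-even =
    subst Even (sym squares) (even-+ degree-sum-even (sumFrom-even (λ j → 2 * t j) 0 n (λ j → t j , refl)))
    where
    t : ℕ → ℕ
    t j = proj₁ (square-parity (deg j))
    squares : sumFrom nbrDegSum 0 n ≡ sumFrom deg 0 n + sumFrom (λ j → 2 * t j) 0 n
    squares = trans nbrDegSum-total
                (trans (sumFrom-cong 0 n (λ j → proj₂ (square-parity (deg j))))
                       (sumFrom-+ deg (λ j → 2 * t j) 0 n))

  -- (vi), Erdős–Gallai: each of the first k vertices has at most k - 1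
  -- neighbours among them, and each later vertex j at most min(d_j, k).
  degree-prefix-bound : ∀ {k} → k ≤ n →
    sumFrom deg 0 k ≤ k * (k ∸ 1) + sumFrom (λ j → deg j ⊓ k) k (n ∸ k)
  degree-prefix-bound {k} k≤n = begin
    sumFrom deg 0 k
      ≡⟨ sumFrom-cong 0 k (λ i → sumFrom-cong 0 n (λ j → sym (*-identityʳ (A i j)))) ⟩
    sumFrom (λ i → sumFrom (λ j → A i j * 1) 0 n) 0 k
      ≡⟨ rows-as-columns k (λ _ → 1) ⟩
    sumFrom (λ j → column k j * 1) 0 n
      ≡⟨ sumFrom-cong 0 n (λ j → *-identityʳ (column k j)) ⟩
    sumFrom (column k) 0 n
      ≡⟨ sumFrom-split-at (column k) k n k≤n ⟩
    sumFrom (column k) 0 k + sumFrom (column k) k (n ∸ k)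
      ≤⟨ +-mono-≤ (sumFrom-mono 0 k (λ j _ j<k → column<k j<k))
                  (sumFrom-mono-≤ k (n ∸ k) (λ j → ⊓-glb (column≤deg k≤n j) (column≤k k j))) ⟩
    sumFrom (λ _ → k ∸ 1) 0 k + sumFrom (λ j → deg j ⊓ k) k (n ∸ k)
      ≡⟨ cong (_+ sumFrom (λ j → deg j ⊓ k) k (n ∸ k)) (sumFrom-const (k ∸ 1) 0 k) ⟩
    k * (k ∸ 1) + sumFrom (λ j → deg j ⊓ k) k (n ∸ k) ∎
    where open ≤-Reasoning

  -- (vii): the same count, each neighbour j weighted by its degree d_j.
  nbrDegSum-prefix-bound : ∀ {k} → k ≤ n →
    sumFrom nbrDegSum 0 k
      ≤ sumFrom (λ j → deg j * (deg j ⊓ (k ∸ 1))) 0 k + sumFrom (λ j → deg j * (deg j ⊓ k)) k (n ∸ k)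
  nbrDegSum-prefix-bound {k} k≤n = begin
    sumFrom nbrDegSum 0 k
      ≡⟨ rows-as-columns k deg ⟩
    sumFrom (λ j → column k j * deg j) 0 n
      ≡⟨ sumFrom-split-at _ k n k≤n ⟩
    sumFrom (λ j → column k j * deg j) 0 k + sumFrom (λ j → column k j * deg j) k (n ∸ k)
      ≤⟨ +-mono-≤ (sumFrom-mono 0 k (λ j _ j<k → weigh (⊓-glb (column≤deg k≤n j) (column<k j<k))))
                  (sumFrom-mono-≤ k (n ∸ k) (λ j → weigh (⊓-glb (column≤deg k≤n j) (column≤k k j)))) ⟩
    sumFrom (λ j → deg j * (deg j ⊓ (k ∸ 1))) 0 k + sumFrom (λ j → deg j * (deg j ⊓ k)) k (n ∸ k) ∎
    where
    open ≤-Reasoning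
    weigh : ∀ {c b j} → c ≤ b → c * deg j ≤ deg j * b
    weigh {c} {b} {j} c≤b = ≤-trans (≤-reflexive (*-comm c (deg j))) (*-monoʳ-≤ (deg j) c≤b)

module NatInRationals where

  open import Data.Nat as ℕ using (ℕ; zero; suc)
  import Data.Nat.Properties as ℕP
  open import Data.Nat.Coprimality using (1-coprimeTo) renaming (sym to coprime-sym)
  open import Data.Integer as ℤ using (+_)
  import Data.Integer.Properties as ℤP
  open import Data.Rational using (ℚ; mkℚ; 0ℚ; _≤_; _<_; _+_; _*_; _-_; -_; _⊓_; _/_; *≤*; *<*; fromℚᵘ; toℚᵘ)
  open import Data.Rational.Properties
  import Data.Rational.Unnormalised as ℚᵘ
  import Data.Rational.Unnormalised.Properties as ℚᵘP
  open import Data.Sum using (inj₁; inj₂)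
  open import Relation.Binary.PropositionalEquality

  -- ℕ→ℚ k is defined by normalising k / 1; nq k is that normal form itself.
  private
    nq : ℕ → ℚ
    nq k = mkℚ (+ k) 0 (coprime-sym (1-coprimeTo k))

    ℕ→ℚ≡nq : ∀ k → ℕ→ℚ k ≡ nq k
    ℕ→ℚ≡nq k = normalize-coprime (coprime-sym (1-coprimeTo k))

  ℕ→ℚ-+ : ∀ a b → ℕ→ℚ (a ℕ.+ b) ≡ ℕ→ℚ a + ℕ→ℚ b
  ℕ→ℚ-+ a b rewrite ℕ→ℚ≡nq (a ℕ.+ b) | ℕ→ℚ≡nq a | ℕ→ℚ≡nq b =
    toℚᵘ-injective (ℚᵘP.≃-trans (ℚᵘ.*≡* numerators) (ℚᵘP.≃-sym (toℚᵘ-homo-+ (nq a) (nq b))))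
    where
    numerators : + (a ℕ.+ b) ℤ.* + 1 ≡ (+ a ℤ.* + 1 ℤ.+ + b ℤ.* + 1) ℤ.* + 1
    numerators = trans (ℤP.*-identityʳ _) (trans (sym (ℤP.pos-+ a b))
                   (sym (trans (ℤP.*-identityʳ _) (cong₂ ℤ._+_ (ℤP.*-identityʳ (+ a)) (ℤP.*-identityʳ (+ b))))))

  ℕ→ℚ-* : ∀ a b → ℕ→ℚ (a ℕ.* b) ≡ ℕ→ℚ a * ℕ→ℚ b
  ℕ→ℚ-* a b rewrite ℕ→ℚ≡nq (a ℕ.* b) | ℕ→ℚ≡nq a | ℕ→ℚ≡nq b =
    toℚᵘ-injective (ℚᵘP.≃-trans (ℚᵘ.*≡* numerators) (ℚᵘP.≃-sym (toℚᵘ-homo-* (nq a) (nq b))))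
    where
    numerators : + (a ℕ.* b) ℤ.* + 1 ≡ (+ a ℤ.* + b) ℤ.* + 1
    numerators = trans (ℤP.*-identityʳ _) (trans (ℤP.pos-* a b) (sym (ℤP.*-identityʳ _)))

  ℕ→ℚ-mono : ∀ {a b} → a ℕ.≤ b → ℕ→ℚ a ≤ ℕ→ℚ b
  ℕ→ℚ-mono {a} {b} a≤b rewrite ℕ→ℚ≡nq a | ℕ→ℚ≡nq b =
    *≤* (subst₂ ℤ._≤_ (sym (ℤP.*-identityʳ (+ a))) (sym (ℤP.*-identityʳ (+ b))) (ℤ.+≤+ a≤b))

  ℕ→ℚ-+-≤ : ∀ a b {c} → a ℕ.+ b ℕ.≤ c → ℕ→ℚ a + ℕ→ℚ b ≤ ℕ→ℚ c
  ℕ→ℚ-+-≤ a b {c} le = subst (_≤ ℕ→ℚ c) (ℕ→ℚ-+ a b) (ℕ→ℚ-mono le)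

  ℕ→ℚ-≤-+ : ∀ a b {c} → c ℕ.≤ a ℕ.+ b → ℕ→ℚ c ≤ ℕ→ℚ a + ℕ→ℚ b
  ℕ→ℚ-≤-+ a b {c} le = subst (ℕ→ℚ c ≤_) (ℕ→ℚ-+ a b) (ℕ→ℚ-mono le)

  ℕ→ℚ-cancel-≤ : ∀ {a b} → ℕ→ℚ a ≤ ℕ→ℚ b → a ℕ.≤ b
  ℕ→ℚ-cancel-≤ {a} {b} le rewrite ℕ→ℚ≡nq a | ℕ→ℚ≡nq b with le
  ... | *≤* p = ℤP.drop‿+≤+ (subst₂ ℤ._≤_ (ℤP.*-identityʳ (+ a)) (ℤP.*-identityʳ (+ b)) p)

  ℕ→ℚ-⊓ : ∀ a b → ℕ→ℚ (a ℕ.⊓ b) ≡ ℕ→ℚ a ⊓ ℕ→ℚ b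
  ℕ→ℚ-⊓ a b with ℕP.≤-total a b
  ... | inj₁ a≤b = trans (cong ℕ→ℚ (ℕP.m≤n⇒m⊓n≡m a≤b)) (sym (p≤q⇒p⊓q≡p (ℕ→ℚ-mono a≤b)))
  ... | inj₂ b≤a = trans (cong ℕ→ℚ (ℕP.m≥n⇒m⊓n≡n b≤a)) (sym (p≥q⇒p⊓q≡q (ℕ→ℚ-mono b≤a)))

  ℕ→ℚ-pos : ∀ e → 0ℚ < ℕ→ℚ e → 0 ℕ.< e
  ℕ→ℚ-pos zero    (*<* (ℤ.+<+ ()))
  ℕ→ℚ-pos (suc e) _ = ℕ.s≤s ℕ.z≤n

  ℕ→ℚ-*-divℚ : ∀ d s → 0 ℕ.< d → ℕ→ℚ d * divℚ s d ≡ ℕ→ℚ s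
  ℕ→ℚ-*-divℚ (suc k) s _ rewrite ℕ→ℚ≡nq (suc k) | ℕ→ℚ≡nq s =
    toℚᵘ-injective (ℚᵘP.≃-trans (toℚᵘ-homo-* (nq (suc k)) (quotient))
      (ℚᵘP.≃-trans (ℚᵘP.*-congˡ {toℚᵘ (nq (suc k))} (toℚᵘ-fromℚᵘ (ℚᵘ.mkℚᵘ (+ s) k)))
                   (ℚᵘ.*≡* numerators)))
    where
    quotient : ℚ
    quotient = fromℚᵘ (ℚᵘ.mkℚᵘ (+ s) k)
    numerators : (+ suc k ℤ.* + s) ℤ.* + 1 ≡ + s ℤ.* + suc (k ℕ.+ 0)
    numerators = trans (ℤP.*-identityʳ _)
                   (trans (ℤP.*-comm (+ suc k) (+ s)) (cong (λ x → + s ℤ.* + suc x) (sym (ℕP.+-identityʳ k))))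

  ℕ→ℚ-double : ∀ t → ℕ→ℚ (2 ℕ.* t) ≡ ℤ→ℚ (+ 2 ℤ.* + t)
  ℕ→ℚ-double t = cong (_/ 1) (ℤP.pos-* 2 t)

  +-cancel-sub : ∀ x c → (x + c) - c ≡ x
  +-cancel-sub x c = trans (+-assoc x c (- c)) (trans (cong (λ z → x + z) (+-inverseʳ c)) (+-identityʳ x))

  ≤-sub-right : ∀ {x c y} → x + c ≤ y → x ≤ y - c
  ≤-sub-right {x} {c} {y} le = subst (_≤ y - c) (+-cancel-sub x c) (+-monoˡ-≤ (- c) le)

  sub-≤-right : ∀ {x c y} → y ≤ x + c → y - c ≤ x
  sub-≤-right {x} {c} {y} le = subst (y - c ≤_) (+-cancel-sub x c) (+-monoˡ-≤ (- c) le)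

module Extension where

  open import Data.Nat
  open import Data.Fin using (Fin; zero; suc; toℕ)
  open import Relation.Binary.PropositionalEquality
  open FiniteSums

  extend : ∀ {n} {X : Set} → X → (Fin n → X) → ℕ → X
  extend {zero}  z f _       = z
  extend {suc n} z f zero    = f zero
  extend {suc n} z f (suc j) = extend {n} z (λ a → f (suc a)) j

  extend-ind : ∀ {n} {X : Set} (P : ℕ → X → Set) (z : X) (f : Fin n → X) →
               (∀ a → P (toℕ a) (f a)) → (∀ i → n ≤ i → P i z) → ∀ i → P i (extend z f i)
  extend-ind {zero}  P z f inside outside i       = outside i z≤n
  extend-ind {suc n} P z f inside outside zero    = inside zero
  extend-ind {suc n} P z f inside outside (suc i) =
    extend-ind (λ j → P (suc j)) z (λ a → f (suc a)) (λ a → inside (suc a)) (λ j n≤j → outside (suc j) (s≤s n≤j)) i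

  extend-toℕ : ∀ {n} {X : Set} (z : X) (f : Fin n → X) a → extend z f (toℕ a) ≡ f a
  extend-toℕ z f zero    = refl
  extend-toℕ z f (suc a) = extend-toℕ z (λ b → f (suc b)) a

  extend-out : ∀ {n} {X : Set} (z : X) (f : Fin n → X) i → n ≤ i → extend z f i ≡ z
  extend-out {zero}  z f i       _         = refl
  extend-out {suc n} z f (suc i) (s≤s n≤i) = extend-out z (λ a → f (suc a)) i n≤i

  sumFin-extend : ∀ {n} (f : Fin n → ℕ) → sumFin f ≡ sumFrom (extend 0 f) 0 n
  sumFin-extend {zero}  f = refl
  sumFin-extend {suc n} f =
    cong (f zero +_) (trans (sumFin-extend (λ a → f (suc a))) (sym (sumFrom-shift (extend 0 f) 0 n)))

module GraphAsMatrix {n : ℕ} (G : SimpleGraph n) where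

  open import Data.Bool using (Bool; true; false; if_then_else_)
  open import Data.Nat
  open import Data.Nat.Properties
  open import Data.Fin using (Fin; toℕ; fromℕ<)
  open import Data.Fin.Properties using (toℕ-fromℕ<)
  open import Relation.Nullary using (yes; no)
  open import Relation.Binary.PropositionalEquality
  open FiniteSums
  open Rearrangement using (Nonincreasing)
  open Extension

  bit : Bool → ℕ
  bit b = if b then 1 else 0

  row : Fin n → ℕ → ℕ
  row a = extend 0 (λ b → bit (adj G a b))

  A : ℕ → ℕ → ℕ
  A = extend (λ _ → 0) row

  A-fin : ∀ a b → A (toℕ a) (toℕ b) ≡ bit (adj G a b)
  A-fin a b = trans (cong (λ r → r (toℕ b)) (extend-toℕ (λ _ → 0) row a)) (extend-toℕ 0 _ b)

  A-outˡ : ∀ i j → n ≤ i → A i j ≡ 0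
  A-outˡ i j n≤i = cong (λ r → r j) (extend-out (λ _ → 0) row i n≤i)

  A-outʳ : ∀ i j → n ≤ j → A i j ≡ 0
  A-outʳ i j n≤j = extend-ind (λ _ r → r j ≡ 0) (λ _ → 0) row (λ a → extend-out 0 _ j n≤j) (λ _ _ → refl) i

  A01 : ∀ i → ZeroOne (A i)
  A01 i j = extend-ind (λ _ r → r j ≤ 1) (λ _ → 0) row
    (λ a → extend-ind (λ _ v → v ≤ 1) 0 _ (λ b → bit≤1 (adj G a b)) (λ _ _ → z≤n) j) (λ _ _ → z≤n) i
    where
    bit≤1 : ∀ b → bit b ≤ 1
    bit≤1 true  = ≤-refl
    bit≤1 false = z≤n

  Asym : ∀ i j → A i j ≡ A j i
  Asym i j = extend-ind (λ i r → r j ≡ A j i) (λ _ → 0) row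
    (λ a → extend-ind (λ j v → v ≡ A j (toℕ a)) 0 _
       (λ b → trans (cong bit (SimpleGraph.sym G a b)) (sym (A-fin b a)))
       (λ j n≤j → sym (A-outˡ j (toℕ a) n≤j)) j)
    (λ i n≤i → sym (A-outʳ j i n≤i)) i

  Airr : ∀ i → A i i ≡ 0
  Airr = extend-ind (λ i r → r i ≡ 0) (λ _ → 0) row
    (λ a → trans (extend-toℕ 0 _ a) (cong bit (irrefl G a))) (λ _ _ → refl)

  open AdjacencyMatrix n A A01 Asym Airr public

  deg-fin : ∀ a → deg (toℕ a) ≡ degree G a
  deg-fin a = trans (cong (λ r → sumFrom r 0 n) (extend-toℕ (λ _ → 0) row a))
                    (sym (sumFin-extend (λ b → bit (adj G a b))))

  deg-out : ∀ i → n ≤ i → deg i ≡ 0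
  deg-out i n≤i = trans (sumFrom-cong 0 n (λ j → A-outˡ i j n≤i)) (sumFrom-zero 0 n)

  nbrDegSum-out : ∀ i → n ≤ i → nbrDegSum i ≡ 0
  nbrDegSum-out i n≤i = trans (sumFrom-cong 0 n (λ j → cong (_* deg j) (A-outˡ i j n≤i))) (sumFrom-zero 0 n)

  nbrDegSum-fin : ∀ a → nbrDegSum (toℕ a) ≡ neighbourDegreeSum G a
  nbrDegSum-fin a = begin
    nbrDegSum (toℕ a)                    ≡⟨ sumFrom-cong 0 n termwise ⟨
    sumFrom (extend 0 nbrDegree) 0 n     ≡⟨ sumFin-extend nbrDegree ⟨
    neighbourDegreeSum G a               ∎
    where
    open ≡-Reasoning
    nbrDegree : Fin n → ℕ
    nbrDegree b = if adj G a b then degree G b else 0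
    term : ∀ b → nbrDegree b ≡ A (toℕ a) (toℕ b) * deg (toℕ b)
    term b rewrite A-fin a b | deg-fin b with adj G a b
    ... | true  = sym (+-identityʳ _)
    ... | false = refl
    termwise : ∀ j → extend 0 nbrDegree j ≡ A (toℕ a) j * deg j
    termwise = extend-ind (λ j v → v ≡ A (toℕ a) j * deg j) 0 nbrDegree term
      (λ j n≤j → trans (sym (*-zeroʳ (A (toℕ a) j))) (cong (A (toℕ a) j *_) (sym (deg-out j n≤j))))

  deg-nonincreasing : (∀ a b → toℕ a ≤ toℕ b → degree G b ≤ degree G a) → Nonincreasing deg
  deg-nonincreasing ordered j with suc j <? n
  ... | yes 1+j<n =
    subst₂ (λ x y → deg x ≤ deg y) (toℕ-fromℕ< 1+j<n) (toℕ-fromℕ< j<n)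
      (subst₂ _≤_ (sym (deg-fin b)) (sym (deg-fin a))
        (ordered a b (subst₂ _≤_ (sym (toℕ-fromℕ< j<n)) (sym (toℕ-fromℕ< 1+j<n)) (n≤1+n j))))
    where
    j<n : j < n
    j<n = <-trans (n<1+n j) 1+j<n
    a b : Fin n
    a = fromℕ< j<n
    b = fromℕ< 1+j<n
  ... | no 1+j≮n = subst (_≤ deg j) (sym (deg-out (suc j) (≮⇒≥ 1+j≮n))) z≤n

module IndexedSums where

  open import Data.Nat as ℕ using (ℕ; zero; suc; _∸_)
  open import Data.Nat.Properties using (+-comm)
  open import Data.Fin using (Fin; toℕ)
  import Data.Fin as Fin
  open import Data.Rational using (ℚ; _+_)
  open import Relation.Binary.PropositionalEquality
  open FiniteSums
  open NatInRationals

  at-ℕ : ∀ {n} (f : Fin n → ℚ) (g : ℕ → ℕ) → (∀ a → f a ≡ ℕ→ℚ (g (toℕ a))) →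
         (∀ j → n ℕ.≤ j → g j ≡ 0) → ∀ j → at f (suc j) ≡ ℕ→ℚ (g j)
  at-ℕ {zero}  f g f≡g out j       = cong ℕ→ℚ (sym (out j ℕ.z≤n))
  at-ℕ {suc n} f g f≡g out zero    = f≡g Fin.zero
  at-ℕ {suc n} f g f≡g out (suc j) =
    at-ℕ (λ a → f (Fin.suc a)) (λ j → g (suc j)) (λ a → f≡g (Fin.suc a)) (λ j n≤j → out (suc j) (ℕ.s≤s n≤j)) j

  sumCount-ℕ : ∀ (F : ℕ → ℚ) (g : ℕ → ℕ) → (∀ j → F (suc j) ≡ ℕ→ℚ (g j)) →
               ∀ a c → sumCount F (suc a) c ≡ ℕ→ℚ (sumFrom g a c)
  sumCount-ℕ F g F≡g a zero    = refl
  sumCount-ℕ F g F≡g a (suc c) =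
    trans (cong₂ _+_ (F≡g a) (sumCount-ℕ F g F≡g (suc a) c)) (sym (ℕ→ℚ-+ (g a) (sumFrom g (suc a) c)))

  sumRange-initial : ∀ (F : ℕ → ℚ) (g : ℕ → ℕ) → (∀ j → F (suc j) ≡ ℕ→ℚ (g j)) →
                     ∀ b → sumRange F 1 b ≡ ℕ→ℚ (sumFrom g 0 b)
  sumRange-initial F g F≡g = sumCount-ℕ F g F≡g 0

  sumRange-final : ∀ (F : ℕ → ℚ) (g : ℕ → ℕ) → (∀ j → F (suc j) ≡ ℕ→ℚ (g j)) →
                   ∀ k n → sumRange F (k ℕ.+ 1) n ≡ ℕ→ℚ (sumFrom g k (n ∸ k))
  sumRange-final F g F≡g k n =
    trans (cong (λ a → sumCount F a (suc n ∸ a)) (+-comm k 1)) (sumCount-ℕ F g F≡g k (n ∸ k))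

open import Data.Nat using (ℕ; _∸_; _⊓_; _⊔_) renaming (_+_ to _+ℕ_; _*_ to _*ℕ_; _<_ to _<ℕ_; _≤_ to _≤ℕ_)
open import Data.Fin using (Fin; toℕ) renaming (_≤_ to _≤ᶠ_)
open import Data.Integer using (ℤ) renaming (_*_ to _*ℤ_)
open import Data.Rational using (ℚ; 0ℚ; _<_; _≤_; _≥_; _*_; _+_; _-_) renaming (_⊓_ to _⊓ℚ_)
open import Data.Product using (Σ; Σ-syntax; ∃-syntax; _×_; _,_)
open import Relation.Binary.PropositionalEquality using (_≡_)

open import Data.Nat using (suc)
open import Data.Nat.Properties using (+-comm; m∸[m∸n]≡n)
open import Data.Fin.Properties using (toℕ<n)
open import Data.Rational using (positive)
open import Data.Rational.Properties using (<⇒≤; ≤-reflexive; positive⁻¹; pos*pos⇒pos; module ≤-Reasoning)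
open import Data.Product using (proj₁; proj₂)
open import Data.Sum using (inj₁; inj₂)
open import Relation.Binary.PropositionalEquality using (module ≡-Reasoning; sym; trans; cong; cong₂; subst; subst₂)
open FiniteSums using (sumFrom; count-gap)
open Rearrangement using (Nonincreasing; ∸-suc; weighted+gap≤top; bottom≤weighted+gap)
open Parity using (Even)
open NatInRationals
open IndexedSums

module Realisation (n : ℕ) (d m : Fin n → ℚ) (G : SimpleGraph n)
  (noIsolated : NoIsolatedVertices G)
  (realises : ∀ i → d i ≡ ℕ→ℚ (degree G i) × m i ≡ avg2Degree G i)
  (ordered : ∀ i j → i ≤ᶠ j → (d i , m i) ⪰ (d j , m j)) where

  open GraphAsMatrix G

  D : Fin n → ℕ
  D a = deg (toℕ a)

  d≡D : ∀ a → d a ≡ ℕ→ℚ (D a)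
  d≡D a = trans (proj₁ (realises a)) (cong ℕ→ℚ (sym (deg-fin a)))

  -- d_i m_i is the sum of the neighbours' degrees, as d_i ≠ 0.
  dm≡nbrDegSum : ∀ a → d a * m a ≡ ℕ→ℚ (nbrDegSum (toℕ a))
  dm≡nbrDegSum a = begin
    d a * m a                                                        ≡⟨ cong₂ _*_ (proj₁ (realises a)) (proj₂ (realises a)) ⟩
    ℕ→ℚ (degree G a) * divℚ (neighbourDegreeSum G a) (degree G a)  ≡⟨ ℕ→ℚ-*-divℚ _ _ (noIsolated a) ⟩
    ℕ→ℚ (neighbourDegreeSum G a)                                    ≡⟨ cong ℕ→ℚ (sym (nbrDegSum-fin a)) ⟩
    ℕ→ℚ (nbrDegSum (toℕ a))                                         ∎
    where open ≡-Reasoning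

  -- The order ⪰ compares degrees first, so the degrees are nonincreasing.
  deg↓ : Nonincreasing deg
  deg↓ = deg-nonincreasing λ a b a≤b →
    ℕ→ℚ-cancel-≤ (subst₂ _≤_ (proj₁ (realises b)) (proj₁ (realises a)) (first-coordinate (ordered a b a≤b)))
    where
    first-coordinate : ∀ {x y u v} → (x , u) ⪰ (y , v) → y ≤ x
    first-coordinate (inj₁ y<x)       = <⇒≤ y<x
    first-coordinate (inj₂ (x≡y , _)) = ≤-reflexive (sym x≡y)

  at-d : ∀ j → at d (suc j) ≡ ℕ→ℚ (deg j)
  at-d = at-ℕ d deg d≡D deg-out

  at-dm : ∀ j → at (λ i → d i * m i) (suc j) ≡ ℕ→ℚ (nbrDegSum j)
  at-dm = at-ℕ (λ i → d i * m i) nbrDegSum dm≡nbrDegSum nbrDegSum-out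

  at-dd : ∀ j → at (λ i → d i * d i) (suc j) ≡ ℕ→ℚ (deg j *ℕ deg j)
  at-dd = at-ℕ (λ i → d i * d i) (λ j → deg j *ℕ deg j)
            (λ a → trans (cong₂ _*_ (d≡D a) (d≡D a)) (sym (ℕ→ℚ-* (D a) (D a))))
            (λ j n≤j → cong (λ x → x *ℕ x) (deg-out j n≤j))

  degree-positive : ∀ a → 0 <ℕ D a × d a ≡ ℕ→ℚ (D a)
  degree-positive a = subst (0 <ℕ_) (sym (deg-fin a)) (noIsolated a) , d≡D a

  product-natural : ∀ a → 0ℚ < d a → 0ℚ < m a → ∃[ e ] (0 <ℕ e × d a * m a ≡ ℕ→ℚ e)
  product-natural a 0<d 0<m =
    nbrDegSum (toℕ a) , ℕ→ℚ-pos _ (subst (0ℚ <_) (dm≡nbrDegSum a) 0<dm) , dm≡nbrDegSum a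
    where
    0<dm : 0ℚ < d a * m a
    0<dm = positive⁻¹ (d a * m a) {{pos*pos⇒pos (d a) {{positive 0<d}} (m a) {{positive 0<m}}}}

  -- (ii): from weighted+gap≤top, the neighbours of vertex a being the unit
  -- weights (a is not among them).
  upper-bound : ∀ a → d a * m a ≤ sumRange (at d) 1 (D a +ℕ 1) - at d ((D a +ℕ 1) ⊓ (toℕ a +ℕ 1))
  upper-bound a = begin
    d a * m a                                              ≡⟨ dm≡nbrDegSum a ⟩
    ℕ→ℚ (nbrDegSum t)                                      ≤⟨ ≤-sub-right (ℕ→ℚ-+-≤ (nbrDegSum t) (deg (δ ⊓ t)) bound) ⟩
    ℕ→ℚ (sumFrom deg 0 (suc δ)) - ℕ→ℚ (deg (δ ⊓ t)) ≡⟨ cong₂ _-_ (sym initial) (sym corner) ⟩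
    sumRange (at d) 1 (δ +ℕ 1) - at d ((δ +ℕ 1) ⊓ (t +ℕ 1)) ∎
    where
    open ≤-Reasoning
    t δ : ℕ
    t = toℕ a
    δ = D a
    bound : nbrDegSum t +ℕ deg (δ ⊓ t) ≤ℕ sumFrom deg 0 (suc δ)
    bound = weighted+gap≤top n deg (A t) t deg↓ (A01 t) (Airr t)
    initial : sumRange (at d) 1 (δ +ℕ 1) ≡ ℕ→ℚ (sumFrom deg 0 (suc δ))
    initial = trans (cong (sumRange (at d) 1) (+-comm δ 1)) (sumRange-initial (at d) deg at-d (suc δ))
    corner : at d ((δ +ℕ 1) ⊓ (t +ℕ 1)) ≡ ℕ→ℚ (deg (δ ⊓ t))
    corner = trans (cong₂ (λ x y → at d (x ⊓ y)) (+-comm δ 1) (+-comm t 1)) (at-d (δ ⊓ t))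

  lower-bound : ∀ a → d a * m a ≥ sumRange (at d) (n ∸ D a) n - at d ((n ∸ D a) ⊔ (toℕ a +ℕ 1))
  lower-bound a = begin
    sumRange (at d) (n ∸ δ) n - at d ((n ∸ δ) ⊔ (t +ℕ 1)) ≡⟨ cong₂ _-_ final corner ⟩
    ℕ→ℚ (sumFrom deg q (suc δ)) - ℕ→ℚ (deg (q ⊔ t)) ≤⟨ sub-≤-right (ℕ→ℚ-≤-+ (nbrDegSum t) (deg (q ⊔ t)) bound) ⟩
    ℕ→ℚ (nbrDegSum t)                                      ≡⟨ sym (dm≡nbrDegSum a) ⟩
    d a * m a                                              ∎
    where
    open ≤-Reasoning
    t δ q : ℕ
    t = toℕ a
    δ = D a
    q = n ∸ suc δ
    bound : sumFrom deg q (suc δ) ≤ℕ nbrDegSum t +ℕ deg (q ⊔ t)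
    bound = bottom≤weighted+gap n deg (A t) t deg↓ (A01 t) (Airr t) (toℕ<n a)
    gap : suc δ ≤ℕ n
    gap = count-gap (A t) t n (A01 t) (Airr t) (toℕ<n a)
    final : sumRange (at d) (n ∸ δ) n ≡ ℕ→ℚ (sumFrom deg q (suc δ))
    final = trans (cong (λ s → sumRange (at d) s n) (∸-suc gap))
              (trans (cong (sumCount (at d) (suc q)) (m∸[m∸n]≡n gap))
                     (sumCount-ℕ (at d) deg at-d q (suc δ)))
    corner : at d ((n ∸ δ) ⊔ (t +ℕ 1)) ≡ ℕ→ℚ (deg (q ⊔ t))
    corner = trans (cong₂ (λ x y → at d (x ⊔ y)) (∸-suc gap) (+-comm t 1)) (at-d (q ⊔ t))

  product-sum : sumRange (at (λ i → d i * m i)) 1 n ≡ sumRange (at (λ i → d i * d i)) 1 n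
  product-sum = trans (sumRange-initial _ nbrDegSum at-dm n)
                  (trans (cong ℕ→ℚ nbrDegSum-total) (sym (sumRange-initial _ _ at-dd n)))

  even-in-ℚ : ∀ {x} (F : ℕ → ℚ) → (∀ j → F (suc j) ≡ ℕ→ℚ (x j)) → Even (sumFrom x 0 n) →
              ∃[ t ] sumRange F 1 n ≡ ℤ→ℚ (ℤ.pos 2 *ℤ t)
  even-in-ℚ F F≡x (t , sum≡2t) =
    ℤ.pos t , trans (sumRange-initial F _ F≡x n) (trans (cong ℕ→ℚ sum≡2t) (ℕ→ℚ-double t))

  degree-sum-even-ℚ : ∃[ t ] sumRange (at d) 1 n ≡ ℤ→ℚ (ℤ.pos 2 *ℤ t)
  degree-sum-even-ℚ = even-in-ℚ (at d) at-d degree-sum-even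

  product-sum-even-ℚ : ∃[ t ] sumRange (at (λ i → d i * m i)) 1 n ≡ ℤ→ℚ (ℤ.pos 2 *ℤ t)
  product-sum-even-ℚ = even-in-ℚ (at (λ i → d i * m i)) at-dm nbrDegSum-even

  degree-prefix : ∀ k → k ≤ℕ n →
    sumRange (at d) 1 k ≤ ℕ→ℚ (k *ℕ (k ∸ 1)) + sumRange (λ j → at d j ⊓ℚ ℕ→ℚ k) (k +ℕ 1) n
  degree-prefix k k≤n = begin
    sumRange (at d) 1 k                                                ≡⟨ sumRange-initial (at d) deg at-d k ⟩
    ℕ→ℚ (sumFrom deg 0 k)                                              ≤⟨ ℕ→ℚ-mono (degree-prefix-bound k≤n) ⟩
    ℕ→ℚ (k *ℕ (k ∸ 1) +ℕ sumFrom (λ j → deg j ⊓ k) k (n ∸ k))          ≡⟨ ℕ→ℚ-+ (k *ℕ (k ∸ 1)) _ ⟩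
    ℕ→ℚ (k *ℕ (k ∸ 1)) + ℕ→ℚ (sumFrom (λ j → deg j ⊓ k) k (n ∸ k))     ≡⟨ cong (ℕ→ℚ (k *ℕ (k ∸ 1)) +_) (sym final) ⟩
    ℕ→ℚ (k *ℕ (k ∸ 1)) + sumRange (λ j → at d j ⊓ℚ ℕ→ℚ k) (k +ℕ 1) n ∎
    where
    open ≤-Reasoning
    final : sumRange (λ j → at d j ⊓ℚ ℕ→ℚ k) (k +ℕ 1) n ≡ ℕ→ℚ (sumFrom (λ j → deg j ⊓ k) k (n ∸ k))
    final = sumRange-final _ (λ j → deg j ⊓ k)
              (λ j → trans (cong (_⊓ℚ ℕ→ℚ k) (at-d j)) (sym (ℕ→ℚ-⊓ (deg j) k))) k n

  product-prefix : ∀ k → k ≤ℕ n →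
    sumRange (at (λ i → d i * m i)) 1 k
      ≤ sumRange (λ j → at d j * (at d j ⊓ℚ ℕ→ℚ (k ∸ 1))) 1 k
        + sumRange (λ j → at d j * (at d j ⊓ℚ ℕ→ℚ k)) (k +ℕ 1) n
  product-prefix k k≤n = begin
    sumRange (at (λ i → d i * m i)) 1 k                            ≡⟨ sumRange-initial _ nbrDegSum at-dm k ⟩
    ℕ→ℚ (sumFrom nbrDegSum 0 k)                                    ≤⟨ ℕ→ℚ-mono (nbrDegSum-prefix-bound k≤n) ⟩
    ℕ→ℚ (sumFrom (capped (k ∸ 1)) 0 k +ℕ sumFrom (capped k) k (n ∸ k))  ≡⟨ ℕ→ℚ-+ (sumFrom (capped (k ∸ 1)) 0 k) _ ⟩
    ℕ→ℚ (sumFrom (capped (k ∸ 1)) 0 k) + ℕ→ℚ (sumFrom (capped k) k (n ∸ k))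
      ≡⟨ cong₂ _+_ (sym (sumRange-initial _ _ (at-capped (k ∸ 1)) k)) (sym (sumRange-final _ _ (at-capped k) k n)) ⟩
    sumRange (λ j → at d j * (at d j ⊓ℚ ℕ→ℚ (k ∸ 1))) 1 k
      + sumRange (λ j → at d j * (at d j ⊓ℚ ℕ→ℚ k)) (k +ℕ 1) n  ∎
    where
    open ≤-Reasoning
    capped : ℕ → ℕ → ℕ
    capped r j = deg j *ℕ (deg j ⊓ r)
    at-capped : ∀ r j → at d (suc j) * (at d (suc j) ⊓ℚ ℕ→ℚ r) ≡ ℕ→ℚ (capped r j)
    at-capped r j = trans (cong₂ _*_ (at-d j) (trans (cong (_⊓ℚ ℕ→ℚ r) (at-d j)) (sym (ℕ→ℚ-⊓ (deg j) r))))
                          (sym (ℕ→ℚ-* (deg j) (deg j ⊓ r)))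

proposition2p6 :
    (n : ℕ) (d m : Fin n → ℚ) →
    (∀ i → 0ℚ < d i × 0ℚ < m i) →
    (∀ i j → i ≤ᶠ j → (d i , m i) ⪰ (d j , m j)) →
    (Σ[ G ∈ SimpleGraph n ] (NoIsolatedVertices G ×
        (∀ i → d i ≡ ℕ→ℚ (degree G i) × m i ≡ avg2Degree G i))) →
    Σ[ D ∈ (Fin n → ℕ) ]
      ((∀ i → 0 <ℕ D i × d i ≡ ℕ→ℚ (D i))
      × (∀ i → ∃[ e ] (0 <ℕ e × d i * m i ≡ ℕ→ℚ e))
      × (∀ i → d i * m i ≤ sumRange (at d) 1 (D i +ℕ 1) - at d ((D i +ℕ 1) ⊓ (toℕ i +ℕ 1)))
      × (∀ i → d i * m i ≥ sumRange (at d) (n ∸ D i) n - at d ((n ∸ D i) ⊔ (toℕ i +ℕ 1)))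
      × sumRange (at (λ i → d i * m i)) 1 n ≡ sumRange (at (λ i → d i * d i)) 1 n
      × (∃[ t ] sumRange (at d) 1 n ≡ ℤ→ℚ (ℤ.pos 2 *ℤ t))
      × (∃[ t ] sumRange (at (λ i → d i * m i)) 1 n ≡ ℤ→ℚ (ℤ.pos 2 *ℤ t))
      × (∀ k → 1 ≤ℕ k → k ≤ℕ n →
          sumRange (at d) 1 k
            ≤ ℕ→ℚ (k *ℕ (k ∸ 1)) + sumRange (λ j → at d j ⊓ℚ ℕ→ℚ k) (k +ℕ 1) n)
      × (∀ k → 1 ≤ℕ k → k ≤ℕ n →
          sumRange (at (λ i → d i * m i)) 1 k
            ≤ sumRange (λ j → at d j * (at d j ⊓ℚ ℕ→ℚ (k ∸ 1))) 1 k
              + sumRange (λ j → at d j * (at d j ⊓ℚ ℕ→ℚ k)) (k +ℕ 1) n))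
proposition2p6 n d m positive ordered (G , noIsolated , realises) =
  D , degree-positive
    , (λ a → product-natural a (proj₁ (positive a)) (proj₂ (positive a)))
    , upper-bound
    , lower-bound
    , product-sum
    , degree-sum-even-ℚ
    , product-sum-even-ℚ
    , (λ k _ → degree-prefix k)
    , (λ k _ → product-prefix k)
  where open Realisation n d m G noIsolated realises ordered
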